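{- Let $x,y,x',y',z\in M$. Then: (i) $pr(x)\cup pr(y)\subseteq pr(z)$ iff $x\subseteq z$ and $y\subseteq z$; (ii) $pr(z)\subseteq pr(x)\cup pr(y)$ iff $z\subseteq x$ or $z\subseteq y$; (iii) $pr(x)\cup pr(y)=pr(z)$ iff ($x\subseteq y$ and $y=z$) or ($y\subseteq x$ and $x=z$); (iv) $pr(x)\cup pr(y)\subseteq pr(x')\cup pr(y')$ iff one of the following holds: (a) $x\subseteq x'$ and $y\subseteq x'$; (b) $x\subseteq y'$ and $y\subseteq y'$; (c) $x\subseteq x'$ and $y\subseteq y'$; (d) $x\subseteq y'$ and $y\subseteq x'$.
   Context: Work in ZFA, i.e. ZF with a set $A$ of atoms. Fix a preorder $\preccurlyeq$ on $A$ with no minimal elements: for every $a\in A$ there is $b\in A$ with $b\preccurlyeq a$ and $a\not\preccurlyeq b$. Define the magmatic hierarchy: $M_1$ is the set of nonempty subsets $x\subseteq A$ that are downward closed ($a\in x$ and $b\preccurlyeq a$ imply $b\in x$); for $\alpha\geq 1$, $M_{\alpha+1}$ is the set of nonempty $x\subseteq M_\alpha$ such that for every $y\in x$, every $z\in M_\alpha$ with $z\subseteq y$ belongs to $x$; $M_\lambda=\bigcup_{1\leq\beta<\lambda}M_\beta$ for limit $\lambda$; $M=\bigcup_{\alpha\geq1}M_\alpha$. For $x\in M$ let $pr(x)=\{y\in M:y\subseteq x\}$. -}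

module Defs where

open import Level using (Level) renaming (suc to lsuc)
open import Data.Empty.Polymorphic using (⊥)
open import Data.Product using (Σ; _×_; _,_)
open import Data.Sum using (_⊎_)
open import Relation.Binary.PropositionalEquality using (_≡_)

-- ZFA universe (Aczel's model of sets, extended with atoms from a set A),
-- the magmatic hierarchy indexed by (Brouwer-style) ordinals ≥ 1, and
-- classes pr(x).
module Magmatic (A : Set) (_≼_ : A → A → Set) where

  data V : Set₁ where
    atom : A → V
    sup  : (I : Set) → (I → V) → V

  infix 4 _≅_ _∈_ _⊆_
  _≅_ : V → V → Set
  atom a  ≅ atom b  = a ≡ b
  atom _  ≅ sup _ _ = ⊥ {Level.zero}
  sup _ _ ≅ atom _  = ⊥ {Level.zero}
  sup I f ≅ sup J g =
    ((i : I) → Σ J λ j → f i ≅ g j) × ((j : J) → Σ I λ i → f i ≅ g j)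

  _∈_ : V → V → Set
  x ∈ atom _  = ⊥ {Level.zero}
  x ∈ sup I f = Σ I λ i → x ≅ f i

  _⊆_ : V → V → Set₁
  x ⊆ y = (w : V) → w ∈ x → w ∈ y

  Nonempty : V → Set₁
  Nonempty x = Σ V λ w → w ∈ x

  IsAtom : V → Set
  IsAtom w = Σ A λ a → w ≅ atom a

  M₁ : V → Set₁
  M₁ x = Nonempty x
       × ((w : V) → w ∈ x → IsAtom w)
       × ((a b : A) → atom a ∈ x → b ≼ a → atom b ∈ x)

  Next : (V → Set₁) → V → Set₁
  Next P x = Nonempty x
           × ((y : V) → y ∈ x → P y)
           × ((y : V) → y ∈ x → (z : V) → P z → z ⊆ y → z ∈ x)

  -- Ordinals ≥ 1 as Brouwer trees; a limit node is the supremum of an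
  -- inhabited family without maximum (so it is a genuine limit ordinal).
  -- β <ₒ α : β is a (structural) strict predecessor of α.
  data Ord : Set₁
  data _<ₒ_ : Ord → Ord → Set₁

  data Ord where
    one  : Ord
    succ : Ord → Ord
    lim  : (I : Set) (f : I → Ord) → I → ((i : I) → Σ I λ j → f i <ₒ f j) → Ord

  data _<ₒ_ where
    <succ : {α β : Ord} → (β ≡ α ⊎ β <ₒ α) → β <ₒ succ α
    <lim  : {β : Ord} {I : Set} {f : I → Ord} {i₀ : I}
            {nm : (i : I) → Σ I λ j → f i <ₒ f j}
            (i : I) → (β ≡ f i ⊎ β <ₒ f i) → β <ₒ lim I f i₀ nm

  -- Mlev α = M_α ;  UpTo α = ⋃_{1≤β≤α} M_β ;  Below α = ⋃_{1≤β<α} M_β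
  Mlev  : Ord → V → Set₁
  UpTo  : Ord → V → Set₁
  Below : Ord → V → Set₁

  Mlev one x            = M₁ x
  Mlev (succ α) x       = Next (Mlev α) x
  Mlev (lim I f _ _) x  = Σ I λ i → UpTo (f i) x

  UpTo α x = Mlev α x ⊎ Below α x

  Below one x           = ⊥
  Below (succ α) x      = UpTo α x
  Below (lim I f _ _) x = Σ I λ i → UpTo (f i) x

  M : V → Set₁
  M x = Σ Ord λ α → Mlev α x

  Class : Set₂
  Class = V → Set₁

  pr : V → Class
  pr x w = M w × w ⊆ x

  infixr 6 _∪_
  infix 4 _⊑_ _≐_
  _∪_ : Class → Class → Class
  (P ∪ Q) w = P w ⊎ Q w

  _⊑_ : Class → Class → Set₁
  P ⊑ Q = (w : V) → P w → Q w

  _≐_ : Class → Class → Set₁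
  P ≐ Q = P ⊑ Q × Q ⊑ P

{-# OPTIONS --safe #-}
-- pr z is the principal class generated by z: for every class P closed
-- downward within M, pr z ⊑ P iff P z.  A union of principal classes is
-- again downward closed, so each inclusion in (i), (ii) and (iv) reduces to
-- evaluating a class at x, y or z; (iii) combines (i) and (ii) with
-- extensionality.
module Submission where

open import Defs
open import Data.Product using (_×_; ∃-syntax; _,_; proj₂)
open import Data.Product.Function.NonDependent.Propositional using (_×-⇔_)
open import Data.Sum using (_⊎_; inj₁; inj₂; [_,_]; map)
open import Data.Sum.Function.Propositional using (_⊎-⇔_)
open import Relation.Nullary using (¬_)
open import Relation.Binary.PropositionalEquality as ≡ using (_≡_)
open import Relation.Binary.Structures using (IsPreorder)
open import Function.Base using (_∘_)
open import Function.Bundles using (_⇔_; mk⇔; Equivalence)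
import Function.Properties.Equivalence as ⇔

×-distrib-⊎⇔ : ∀ {a b c d} {P : Set a} {Q : Set b} {R : Set c} {S : Set d}
  → ((P ⊎ Q) × (R ⊎ S)) ⇔ ((P × R) ⊎ (Q × S) ⊎ (P × S) ⊎ (Q × R))
×-distrib-⊎⇔ {P = P} {Q = Q} {R = R} {S = S} = mk⇔ to from
  where
  to : (P ⊎ Q) × (R ⊎ S) → (P × R) ⊎ (Q × S) ⊎ (P × S) ⊎ (Q × R)
  to (inj₁ p , inj₁ r) = inj₁ (p , r)
  to (inj₂ q , inj₂ s) = inj₂ (inj₁ (q , s))
  to (inj₁ p , inj₂ s) = inj₂ (inj₂ (inj₁ (p , s)))
  to (inj₂ q , inj₁ r) = inj₂ (inj₂ (inj₂ (q , r)))
  from : (P × R) ⊎ (Q × S) ⊎ (P × S) ⊎ (Q × R) → (P ⊎ Q) × (R ⊎ S)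
  from (inj₁ (p , r))               = inj₁ p , inj₁ r
  from (inj₂ (inj₁ (q , s)))        = inj₂ q , inj₂ s
  from (inj₂ (inj₂ (inj₁ (p , s)))) = inj₁ p , inj₂ s
  from (inj₂ (inj₂ (inj₂ (q , r)))) = inj₂ q , inj₁ r

module MagmaticProperties (A : Set) (_≼_ : A → A → Set) where
  open Magmatic A _≼_

  ≅-refl : (x : V) → x ≅ x
  ≅-refl (atom a)  = ≡.refl
  ≅-refl (sup I f) = (λ i → i , ≅-refl (f i)) , (λ j → j , ≅-refl (f j))

  ≅-sym : (x y : V) → x ≅ y → y ≅ x
  ≅-sym (atom a)  (atom b)  a≡b     = ≡.sym a≡b
  ≅-sym (sup I f) (sup J g) (p , q) =
    (λ j → let i , fi≅gj = q j in i , ≅-sym (f i) (g j) fi≅gj) ,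
    (λ i → let j , fi≅gj = p i in j , ≅-sym (f i) (g j) fi≅gj)

  ≅-trans : (x y z : V) → x ≅ y → y ≅ z → x ≅ z
  ≅-trans (atom a)  (atom b)  (atom c)  a≡b     b≡c       = ≡.trans a≡b b≡c
  ≅-trans (sup I f) (sup J g) (sup K h) (p , q) (p′ , q′) =
    (λ i → let j , fi≅gj = p i ; k , gj≅hk = p′ j
           in k , ≅-trans (f i) (g j) (h k) fi≅gj gj≅hk) ,
    (λ k → let j , gj≅hk = q′ k ; i , fi≅gj = q j
           in i , ≅-trans (f i) (g j) (h k) fi≅gj gj≅hk)

  ∈-respʳ-≅ : (w y z : V) → w ∈ y → y ≅ z → w ∈ z
  ∈-respʳ-≅ w (sup I f) (sup J g) (i , w≅fi) (p , _) =
    let j , fi≅gj = p i in j , ≅-trans w (f i) (g j) w≅fi fi≅gj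

  ≅⇒⊆ : (y z : V) → y ≅ z → y ⊆ z
  ≅⇒⊆ y z y≅z w w∈y = ∈-respʳ-≅ w y z w∈y y≅z

  ⊆-trans : {x y z : V} → x ⊆ y → y ⊆ z → x ⊆ z
  ⊆-trans x⊆y y⊆z w w∈x = y⊆z w (x⊆y w w∈x)

  -- Nonemptiness rules out atoms, which have no elements yet are not ≅ to ∅.
  ⊆-antisym : (y z : V) → Nonempty y → y ⊆ z → z ⊆ y → y ≅ z
  ⊆-antisym (atom a)  _         (_ , ())
  ⊆-antisym (sup I f) (atom b)  (w , w∈y) y⊆z _ with () ← y⊆z w w∈y
  ⊆-antisym (sup I f) (sup J g) _         y⊆z z⊆y =
    (λ i → y⊆z (f i) (i , ≅-refl (f i))) ,
    (λ j → let i , gj≅fi = z⊆y (g j) (j , ≅-refl (g j))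
           in i , ≅-sym (g j) (f i) gj≅fi)

  Mlev⇒Nonempty  : (α : Ord) {x : V} → Mlev α x → Nonempty x
  UpTo⇒Nonempty  : (α : Ord) {x : V} → UpTo α x → Nonempty x
  Below⇒Nonempty : (α : Ord) {x : V} → Below α x → Nonempty x

  Mlev⇒Nonempty one           (x≢∅ , _)  = x≢∅
  Mlev⇒Nonempty (succ α)      (x≢∅ , _)  = x≢∅
  Mlev⇒Nonempty (lim I f _ _) (i , x∈Mfi) = UpTo⇒Nonempty (f i) x∈Mfi

  UpTo⇒Nonempty α = [ Mlev⇒Nonempty α , Below⇒Nonempty α ]

  Below⇒Nonempty one           ()
  Below⇒Nonempty (succ α)      x∈M≤α       = UpTo⇒Nonempty α x∈M≤α
  Below⇒Nonempty (lim I f _ _) (i , x∈Mfi) = UpTo⇒Nonempty (f i) x∈Mfi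

  M⇒Nonempty : {x : V} → M x → Nonempty x
  M⇒Nonempty (α , x∈Mα) = Mlev⇒Nonempty α x∈Mα

  DownClosed : Class → Set₁
  DownClosed P = {v w : V} → M v → v ⊆ w → P w → P v

  pr-downClosed : (x : V) → DownClosed (pr x)
  pr-downClosed x Mv v⊆w (_ , w⊆x) = Mv , ⊆-trans v⊆w w⊆x

  ∪-downClosed : {P Q : Class} → DownClosed P → DownClosed Q → DownClosed (P ∪ Q)
  ∪-downClosed P↓ Q↓ Mv v⊆w = map (P↓ Mv v⊆w) (Q↓ Mv v⊆w)

  ∪-⊑⇔ : {P Q R : Class} → (P ∪ Q ⊑ R) ⇔ (P ⊑ R × Q ⊑ R)
  ∪-⊑⇔ = mk⇔ (λ P∪Q⊑R → (λ w → P∪Q⊑R w ∘ inj₁) , (λ w → P∪Q⊑R w ∘ inj₂))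
             (λ (P⊑R , Q⊑R) w → [ P⊑R w , Q⊑R w ])

  pr-∋⇔ : {x z : V} → M x → pr z x ⇔ x ⊆ z
  pr-∋⇔ Mx = mk⇔ proj₂ (Mx ,_)

  pr-⊑⇔ : {z : V} {P : Class} → M z → DownClosed P → (pr z ⊑ P) ⇔ P z
  pr-⊑⇔ {z} Mz P↓ = mk⇔ (λ pr-z⊑P → pr-z⊑P z (Mz , λ _ w∈z → w∈z))
                         (λ Pz w (Mw , w⊆z) → P↓ Mw w⊆z Pz)

  pr-⊑-pr⇔ : {x z : V} → M x → (pr x ⊑ pr z) ⇔ x ⊆ z
  pr-⊑-pr⇔ {z = z} Mx = ⇔.trans (pr-⊑⇔ Mx (pr-downClosed z)) (pr-∋⇔ Mx)

  pr-⊑-∪-pr⇔ : {x y z : V} → M z → (pr z ⊑ pr x ∪ pr y) ⇔ (z ⊆ x ⊎ z ⊆ y)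
  pr-⊑-∪-pr⇔ {x} {y} Mz =
    ⇔.trans (pr-⊑⇔ Mz (∪-downClosed (pr-downClosed x) (pr-downClosed y)))
            (pr-∋⇔ Mz ⊎-⇔ pr-∋⇔ Mz)

  ∪-pr-⊑-pr⇔ : {x y z : V} → M x → M y → (pr x ∪ pr y ⊑ pr z) ⇔ (x ⊆ z × y ⊆ z)
  ∪-pr-⊑-pr⇔ Mx My = ⇔.trans ∪-⊑⇔ (pr-⊑-pr⇔ Mx ×-⇔ pr-⊑-pr⇔ My)

  ∪-pr-⊑-∪-pr⇔ : {x y x′ y′ : V} → M x → M y
    → (pr x ∪ pr y ⊑ pr x′ ∪ pr y′)
    ⇔ ((x ⊆ x′ × y ⊆ x′) ⊎ (x ⊆ y′ × y ⊆ y′) ⊎ (x ⊆ x′ × y ⊆ y′) ⊎ (x ⊆ y′ × y ⊆ x′))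
  ∪-pr-⊑-∪-pr⇔ Mx My =
    ⇔.trans ∪-⊑⇔ (⇔.trans (pr-⊑-∪-pr⇔ Mx ×-⇔ pr-⊑-∪-pr⇔ My) ×-distrib-⊎⇔)

  ∪-pr-≐-pr⇔ : {x y z : V} → M x → M y → M z
    → (pr x ∪ pr y ≐ pr z) ⇔ ((x ⊆ y × y ≅ z) ⊎ (y ⊆ x × x ≅ z))
  ∪-pr-≐-pr⇔ {x} {y} {z} Mx My Mz = mk⇔ to from
    where
    open Equivalence using () renaming (to to ⇒; from to ⇐)
    to : pr x ∪ pr y ≐ pr z → (x ⊆ y × y ≅ z) ⊎ (y ⊆ x × x ≅ z)
    to (∪⊑z , z⊑∪) with ⇒ (∪-pr-⊑-pr⇔ Mx My) ∪⊑z | ⇒ (pr-⊑-∪-pr⇔ Mz) z⊑∪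
    ... | x⊆z , y⊆z | inj₁ z⊆x = inj₂ (⊆-trans y⊆z z⊆x , ⊆-antisym x z (M⇒Nonempty Mx) x⊆z z⊆x)
    ... | x⊆z , y⊆z | inj₂ z⊆y = inj₁ (⊆-trans x⊆z z⊆y , ⊆-antisym y z (M⇒Nonempty My) y⊆z z⊆y)
    from : (x ⊆ y × y ≅ z) ⊎ (y ⊆ x × x ≅ z) → pr x ∪ pr y ≐ pr z
    from (inj₁ (x⊆y , y≅z)) =
      ⇐ (∪-pr-⊑-pr⇔ Mx My) (⊆-trans x⊆y (≅⇒⊆ y z y≅z) , ≅⇒⊆ y z y≅z) ,
      ⇐ (pr-⊑-∪-pr⇔ Mz) (inj₂ (≅⇒⊆ z y (≅-sym y z y≅z)))
    from (inj₂ (y⊆x , x≅z)) =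
      ⇐ (∪-pr-⊑-pr⇔ Mx My) (≅⇒⊆ x z x≅z , ⊆-trans y⊆x (≅⇒⊆ x z x≅z)) ,
      ⇐ (pr-⊑-∪-pr⇔ Mz) (inj₁ (≅⇒⊆ z x (≅-sym x z x≅z)))

lemma3p2 : (A : Set) (_≼_ : A → A → Set)
    → IsPreorder _≡_ _≼_
    → ((a : A) → ∃[ b ] (b ≼ a × ¬ (a ≼ b)))
    → let open Magmatic A _≼_ in
      (x y x' y' z : V) → M x → M y → M x' → M y' → M z
    → ((pr x ∪ pr y ⊑ pr z) ⇔ (x ⊆ z × y ⊆ z))
    × ((pr z ⊑ pr x ∪ pr y) ⇔ (z ⊆ x ⊎ z ⊆ y))
    × ((pr x ∪ pr y ≐ pr z) ⇔ ((x ⊆ y × y ≅ z) ⊎ (y ⊆ x × x ≅ z)))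
    × ((pr x ∪ pr y ⊑ pr x' ∪ pr y')
        ⇔ ((x ⊆ x' × y ⊆ x') ⊎ (x ⊆ y' × y ⊆ y') ⊎ (x ⊆ x' × y ⊆ y') ⊎ (x ⊆ y' × y ⊆ x')))
lemma3p2 A _≼_ _ _ x y x' y' z Mx My _ _ Mz =
  ∪-pr-⊑-pr⇔ Mx My ,
  pr-⊑-∪-pr⇔ Mz ,
  ∪-pr-≐-pr⇔ Mx My Mz ,
  ∪-pr-⊑-∪-pr⇔ Mx My
  where open MagmaticProperties A _≼_
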